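{- For all $n\ge 1$ and $t\ge 0$: $\mu_U(n,t,n)=\mu_U(n,t,n-1)=0$ and $\mu_D(n,t,1)=\mu_D(n,t,2)=0$.
   Context: Sorting procedure: a permutation $\pi$ is processed using an input sequence (initially $\pi_1,\ldots,\pi_n$), a stack and an output. Let $m$ be the smallest value not yet output. At each step: if the stack's top entry equals $m$, pop it to the output; otherwise, if the input is nonempty, push the next input entry onto the stack. When no move is possible and the stack is nonempty, the remaining stack entries are returned to the input in the reverse of their order in the previous input (i.e. listed from top of stack to bottom), and the procedure is repeated. The rev-tier is the number of times entries must be returned to the input before the output is $1,2,\ldots,n$. For $\sigma\in S_n$, $(i,i+1)$ is a separated pair if some entry $k>i+1$ lies between $i$ and $i+1$ in $\sigma$; it is up separated if $i$ precedes $i+1$, down separated otherwise. An ISASP is a sequence of separated pairs $(i_1,i_1+1),\ldots,(i_p,i_p+1)$ with $i_1<\cdots<i_p$ and alternating orientations. $\sigma$ is up-oriented (resp. down-oriented) if it has a separated pair and every maximum length ISASP begins with an up (resp. down) separated pair; $M_U$, $M_D$ denote these sets. $\mu_U(n,t,k)$ (resp. $\mu_D(n,t,k)$) is the number of permutations in $M_U$ (resp. $M_D$) of length $n$, rev-tier $t$, with $1$ in position $k$ (taken to be $0$ if $k\notin\{1,\ldots,n\}$). -}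

module Defs where

open import Data.Nat using (ℕ; zero; suc; _+_; _∸_; _≡ᵇ_; _<ᵇ_)
open import Data.Bool using (Bool; true; false; _∧_; _∨_; not; if_then_else_)
open import Data.List using (List; []; _∷_; map; concatMap; length; filterᵇ; take; drop; foldr; applyUpTo)

anyᵇ : {A : Set} → (A → Bool) → List A → Bool
anyᵇ p []       = false
anyᵇ p (x ∷ xs) = p x ∨ anyᵇ p xs

allᵇ : {A : Set} → (A → Bool) → List A → Bool
allᵇ p []       = true
allᵇ p (x ∷ xs) = p x ∧ allᵇ p xs
open import Data.Product using (_×_; _,_)

-- Permutations of length n, in one-line notation, as lists of the
-- values 1..n.  perms n enumerates every element of S_n exactly once
-- (insert the value n into every slot of each permutation of 1..n-1).

insertAll : ℕ → List ℕ → List (List ℕ)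
insertAll x []       = (x ∷ []) ∷ []
insertAll x (y ∷ ys) = (x ∷ y ∷ ys) ∷ map (y ∷_) (insertAll x ys)

perms : ℕ → List (List ℕ)
perms zero    = [] ∷ []
perms (suc n) = concatMap (insertAll (suc n)) (perms n)

-- 1-based position of (the first occurrence of) v in σ; 0 if absent.
pos : ℕ → List ℕ → ℕ
pos v []       = 0
pos v (x ∷ xs) = if x ≡ᵇ v then 1 else (if pos v xs ≡ᵇ 0 then 0 else suc (pos v xs))

-- The sorting procedure.  The stack is a list whose head is the top.
-- m is the smallest value not yet output.

popAll : List ℕ → ℕ → List ℕ × ℕ
popAll []       m = [] , m
popAll (x ∷ xs) m = if x ≡ᵇ m then popAll xs (suc m) else (x ∷ xs , m)

pass : List ℕ → List ℕ → ℕ → List ℕ × ℕ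
pass input stack m with popAll stack m
pass []       stack m | s , m' = s , m'
pass (x ∷ xs) stack m | s , m' = pass xs (x ∷ s) m'

-- number of returns of the stack to the input, with fuel.  The new input
-- is the stack listed from top to bottom (= the stack list itself).
-- Each pass outputs at least one entry, so fuel (length π + 1) is never
-- exhausted.
revTierAux : ℕ → List ℕ → ℕ → ℕ
revTierAux zero       input m = 0
revTierAux (suc fuel) input m with pass input [] m
... | [] , m'      = 0
... | (s ∷ ss) , m' = suc (revTierAux fuel (s ∷ ss) m')

revTier : List ℕ → ℕ
revTier π = revTierAux (suc (length π)) π 1

-- Separated pairs.  A pair is recorded as (i , up?) where up? = true
-- iff i precedes i+1 in σ.

-- entries strictly between positions p and q (1-based, p < q)
between : ℕ → ℕ → List ℕ → List ℕ
between p q σ = take (q ∸ p ∸ 1) (drop p σ)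

isSeparated : List ℕ → ℕ → Bool
isSeparated σ i =
  let p = pos i σ ; q = pos (suc i) σ
  in anyᵇ (λ k → suc i <ᵇ k)
         (if p <ᵇ q then between p q σ else between q p σ)

isUp : List ℕ → ℕ → Bool
isUp σ i = pos i σ <ᵇ pos (suc i) σ

sepPairs : List ℕ → List (ℕ × Bool)
sepPairs σ = map (λ i → i , isUp σ i)
                 (filterᵇ (isSeparated σ) (applyUpTo suc (length σ ∸ 1)))

hasSeparatedPair : List ℕ → Bool
hasSeparatedPair σ with sepPairs σ
... | []    = false
... | _ ∷ _ = true

sublists : {A : Set} → List A → List (List A)
sublists []       = [] ∷ []
sublists (x ∷ xs) = map (x ∷_) (sublists xs) Data.List.++ sublists xs

alternating : List (ℕ × Bool) → Bool
alternating []                          = true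
alternating (_ ∷ [])                    = true
alternating ((_ , a) ∷ (j , b) ∷ rest)  = (a Data.Bool.xor b) ∧ alternating ((j , b) ∷ rest)

-- ISASPs: sequences of separated pairs with increasing i (a subsequence
-- of sepPairs, which is sorted by i) and alternating orientations
isasps : List ℕ → List (List (ℕ × Bool))
isasps σ = filterᵇ alternating (sublists (sepPairs σ))

maxISASPLength : List ℕ → ℕ
maxISASPLength σ = foldr Data.Nat._⊔_ 0 (map length (isasps σ))

beginsWith : Bool → List (ℕ × Bool) → Bool
beginsWith o []            = false
beginsWith o ((_ , b) ∷ _) = if o then b else not b

-- o = true: up-oriented (M_U); o = false: down-oriented (M_D)
oriented : Bool → List ℕ → Bool
oriented o σ =
  hasSeparatedPair σ ∧
  allᵇ (λ s → if length s ≡ᵇ maxISASPLength σ then beginsWith o s else true)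
      (isasps σ)

isUpOriented : List ℕ → Bool
isUpOriented = oriented true

isDownOriented : List ℕ → Bool
isDownOriented = oriented false

-- The counts μ_U(n,t,k), μ_D(n,t,k).  Positions are 1-based, so for
-- k ∉ {1..n} the count is automatically 0.

count : (List ℕ → Bool) → ℕ → ℕ → ℕ → ℕ
count M n t k =
  length (filterᵇ (λ σ → M σ ∧ (revTier σ ≡ᵇ t) ∧ (pos 1 σ ≡ᵇ k)) (perms n))

μU : ℕ → ℕ → ℕ → ℕ
μU = count isUpOriented

μD : ℕ → ℕ → ℕ → ℕ
μD = count isDownOriented

module Submission where

-- A permutation σ of 1..n is seen through its position function
-- v ↦ pos v σ.  The key fact is purely about such position functions
-- (a "layout", Layout below): scan k = 1, 2, 3, ... ; while the pairs
-- (k, k+1) are not separated, the values 1..k occupy a contiguous block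
-- of positions (Block), because a gap next to the block would hold a
-- value > k+1 lying between k and k+1.  If 1 sits at position n or n-1,
-- the block always reaches position n-1, which forces the first
-- separated pair to be a down pair (ascent-has-earlier-descent): every
-- up separated pair (i, i+1) has a down separated pair (j, j+1) with
-- j < i.  Mirroring positions x ↦ n+1-x swaps up and down and turns
-- "1 at position 1 or 2" into "1 at position n or n-1", giving the dual
-- statement (descent-has-earlier-ascent).
-- Consequently an ISASP beginning with an up (resp. down) pair can be
-- lengthened at the front, so no maximum length ISASP begins that way
-- (not-oriented), σ is not up- (resp. down-) oriented, and the counts
-- μ_U(n,t,n), μ_U(n,t,n-1), μ_D(n,t,1), μ_D(n,t,2) vanish.

open import Defs
open import Data.Nat using (ℕ; _≤_; _∸_)
open import Data.Product using (_×_)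
open import Relation.Binary.PropositionalEquality using (_≡_)

open import Data.Nat using (zero; suc; _+_; _<_; _≡ᵇ_; _<ᵇ_; _⊔_; z≤n; s≤s; s≤s⁻¹; z<s; _≟_; _≤?_)
open import Data.Nat.Properties
open import Data.Bool using (Bool; true; false; T; not; _∧_; if_then_else_)
open import Data.Product using (_,_; proj₁; proj₂; ∃-syntax; ∃₂)
open import Data.Sum using (_⊎_; inj₁; inj₂)
open import Data.Empty using (⊥-elim)
open import Function using (_∘_)
open import Relation.Nullary using (¬_; Dec; yes; no; T?)
open import Relation.Binary.PropositionalEquality using (_≢_; refl; sym; trans; cong; subst; setoid)
open import Data.Bool.Properties using (T-≡; T-∨; T-∧)
open import Function.Bundles using (Equivalence)
open import Data.List using (List; []; _∷_; map; length; take; drop; foldr; applyUpTo; applyDownFrom)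
open import Data.List.Properties using (∷-injectiveˡ; length-applyDownFrom; filter-none)
open import Data.List.Membership.Propositional using (_∈_; find)
open import Data.List.Membership.Propositional.Properties
  using (∈-map⁻; ∈-map⁺; ∈-++⁻; ∈-++⁺ˡ; ∈-++⁺ʳ; ∈-concatMap⁻; ∈-filter⁻; ∈-filter⁺;
         ∈-applyUpTo⁻; ∈-applyUpTo⁺; ∈-applyDownFrom⁻; ∈-applyDownFrom⁺)
open import Data.List.Relation.Unary.Any using (here; there)
import Data.List.Relation.Unary.All as All
open import Data.List.Relation.Unary.AllPairs using (AllPairs; _∷_)
import Data.List.Relation.Unary.AllPairs.Properties as AllPairs
open import Data.List.Relation.Unary.Unique.Propositional using (Unique)
open import Data.List.Relation.Unary.Unique.Propositional.Properties using (applyDownFrom⁺₁)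
open import Data.List.Relation.Binary.Permutation.Propositional
  using (_↭_; prep; swap; ↭-refl; ↭-sym; ↭-trans; ↭⇒↭ₛ)
open import Data.List.Relation.Binary.Permutation.Propositional.Properties using (∈-resp-↭; ↭-length)
open import Data.List.Relation.Binary.Permutation.Setoid.Properties (setoid ℕ) using (Unique-resp-↭)

Between : ℕ → ℕ → ℕ → Set
Between a b c = (a < c × c < b) ⊎ (b < c × c < a)

infix 4 _∈[_⋯_]
_∈[_⋯_] : ℕ → ℕ → ℕ → Set
x ∈[ a ⋯ b ] = a ≤ x × x ≤ b

right-end : ∀ {a b q x} → suc b ≡ q → x ∈[ a ⋯ q ] → x ∈[ a ⋯ b ] ⊎ x ≡ q
right-end refl (a≤x , x≤q) with m≤n⇒m<n∨m≡n x≤q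
... | inj₁ x<q = inj₁ (a≤x , s≤s⁻¹ x<q)
... | inj₂ x≡q = inj₂ x≡q

right-end⁻ : ∀ {a b q x} → suc b ≡ q → a ≤ q → x ∈[ a ⋯ b ] ⊎ x ≡ q → x ∈[ a ⋯ q ]
right-end⁻ refl _   (inj₁ (a≤x , x≤b)) = a≤x , m≤n⇒m≤1+n x≤b
right-end⁻ refl a≤q (inj₂ refl)        = a≤q , ≤-refl

left-end : ∀ {a b q x} → suc q ≡ a → x ∈[ q ⋯ b ] → x ∈[ a ⋯ b ] ⊎ x ≡ q
left-end refl (q≤x , x≤b) with m≤n⇒m<n∨m≡n q≤x
... | inj₁ q<x = inj₁ (q<x , x≤b)
... | inj₂ q≡x = inj₂ (sym q≡x)

left-end⁻ : ∀ {a b q x} → suc q ≡ a → q ≤ b → x ∈[ a ⋯ b ] ⊎ x ≡ q → x ∈[ q ⋯ b ]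
left-end⁻ refl _   (inj₁ (q<x , x≤b)) = <⇒≤ q<x , x≤b
left-end⁻ refl q≤b (inj₂ refl)        = ≤-refl , q≤b

-- An abstract permutation of 1..size: `at v` is the position of the value
-- v, a bijection of [1, size]; `sep i` decides whether (i, i+1) is
-- separated, i.e. whether a value k > i+1 sits between them.
record Layout : Set where
  field
    size : ℕ
    at   : ℕ → ℕ
    sep  : ℕ → Bool
    at-range : ∀ {v} → v ∈[ 1 ⋯ size ] → at v ∈[ 1 ⋯ size ]
    at-inj   : ∀ {v w} → v ∈[ 1 ⋯ size ] → w ∈[ 1 ⋯ size ] → at v ≡ at w → v ≡ w
    at-onto  : ∀ {x} → x ∈[ 1 ⋯ size ] → ∃[ v ] v ∈[ 1 ⋯ size ] × at v ≡ x
    sep-sound : ∀ {i} → 1 ≤ i → suc i ≤ size → T (sep i) →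
      ∃[ k ] suc i < k × k ≤ size × Between (at i) (at (suc i)) (at k)
    sep-complete : ∀ {i k} → 1 ≤ i → suc i < k → k ≤ size →
      Between (at i) (at (suc i)) (at k) → T (sep i)

module Blocks (L : Layout) where
  open Layout L renaming (size to n)

  Block : ℕ → ℕ → ℕ → Set
  Block k a b = ∀ {v} → v ∈[ 1 ⋯ n ] → (v ≤ k → at v ∈[ a ⋯ b ]) × (at v ∈[ a ⋯ b ] → v ≤ k)

  block-one : Block 1 (at 1) (at 1)
  block-one {v} v∈@(1≤v , v≤n) = inside , only-one
    where
    one∈ : 1 ∈[ 1 ⋯ n ]
    one∈ = ≤-refl , ≤-trans 1≤v v≤n
    inside : v ≤ 1 → at v ∈[ at 1 ⋯ at 1 ]
    inside v≤1 rewrite ≤-antisym v≤1 1≤v = ≤-refl , ≤-refl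
    only-one : at v ∈[ at 1 ⋯ at 1 ] → v ≤ 1
    only-one (l , u) = ≤-reflexive (at-inj v∈ one∈ (≤-antisym u l))

  block-extend : ∀ {k a b a′ b′} → suc k ≤ n → Block k a b →
    (∀ {x} → x ∈[ a′ ⋯ b′ ] → x ∈[ a ⋯ b ] ⊎ x ≡ at (suc k)) →
    (∀ {x} → x ∈[ a ⋯ b ] ⊎ x ≡ at (suc k) → x ∈[ a′ ⋯ b′ ]) →
    Block (suc k) a′ b′
  block-extend {k} {a′ = a′} {b′} k<n block split join {v} v∈ = grow , shrink
    where
    grow : v ≤ suc k → at v ∈[ a′ ⋯ b′ ]
    grow v≤k+1 with m≤n⇒m<n∨m≡n v≤k+1
    ... | inj₁ v≤k  = join (inj₁ (proj₁ (block v∈) (s≤s⁻¹ v≤k)))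
    ... | inj₂ refl = join (inj₂ refl)
    shrink : at v ∈[ a′ ⋯ b′ ] → v ≤ suc k
    shrink x∈ with split x∈
    ... | inj₁ x∈ab = m≤n⇒m≤1+n (proj₂ (block v∈) x∈ab)
    ... | inj₂ x≡q  = ≤-reflexive (at-inj v∈ (s≤s z≤n , k<n) x≡q)

  -- a position outside the block of 1..k, strictly between the positions
  -- of k and k+1, holds a value larger than k+1, so (k, k+1) is separated
  gap-separates : ∀ {k a b x} → 1 ≤ k → suc k ≤ n → Block k a b →
    x ∈[ 1 ⋯ n ] → ¬ x ∈[ a ⋯ b ] → x ≢ at (suc k) →
    Between (at k) (at (suc k)) x → T (sep k)
  gap-separates {k} 1≤k k<n block x∈ x∉ x≢ btw with at-onto x∈
  ... | w , w∈ , refl = sep-complete 1≤k k+1<w (proj₂ w∈) btw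
    where
    k+1<w : suc k < w
    k+1<w = ≤∧≢⇒< (≰⇒> (λ w≤k → x∉ (proj₁ (block w∈) w≤k))) (λ e → x≢ (cong at (sym e)))

  block-grow : ∀ {k a b} → 1 ≤ k → suc k ≤ n → Block k a b → ¬ T (sep k) →
    ∃₂ λ a′ b′ → a′ ≤ a × b ≤ b′ × Block (suc k) a′ b′
  block-grow {k} {a} {b} 1≤k k<n block ¬sep = place (a ≤? at (suc k))
    where
    Grown : Set
    Grown = ∃₂ λ a′ b′ → a′ ≤ a × b ≤ b′ × Block (suc k) a′ b′
    k∈ : k ∈[ 1 ⋯ n ]
    k∈ = 1≤k , ≤-trans (n≤1+n k) k<n
    atk∈ : at k ∈[ a ⋯ b ]
    atk∈ = proj₁ (block k∈) ≤-refl
    q∉ : ¬ at (suc k) ∈[ a ⋯ b ]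
    q∉ q∈ab = 1+n≰n (proj₂ (block (s≤s z≤n , k<n)) q∈ab)

    grow-right : a ≤ at (suc k) → b < at (suc k) → Grown
    grow-right a≤q b<q with suc b ≟ at (suc k)
    ... | yes b+1≡q = a , at (suc k) , ≤-refl , <⇒≤ b<q ,
          block-extend k<n block (right-end b+1≡q) (right-end⁻ b+1≡q a≤q)
    ... | no b+1≢q = ⊥-elim (¬sep (gap-separates 1≤k k<n block
          (s≤s z≤n , ≤-trans (<⇒≤ b+1<q) (proj₂ (at-range (s≤s z≤n , k<n))))
          (λ (_ , b+1≤b) → 1+n≰n b+1≤b) (<⇒≢ b+1<q) (inj₁ (s≤s (proj₂ atk∈) , b+1<q))))
      where
      b+1<q : suc b < at (suc k)
      b+1<q = ≤∧≢⇒< b<q b+1≢q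

    grow-left : at (suc k) < a → Grown
    grow-left q<a with suc (at (suc k)) ≟ a
    ... | yes q+1≡a = at (suc k) , b , <⇒≤ q<a , ≤-refl ,
          block-extend k<n block (left-end q+1≡a)
            (left-end⁻ q+1≡a (≤-trans (<⇒≤ q<a) (≤-trans (proj₁ atk∈) (proj₂ atk∈))))
    ... | no q+1≢a = ⊥-elim (¬sep (gap-separates 1≤k k<n block
          (s≤s z≤n , ≤-trans (<⇒≤ q+1<a) (≤-trans (proj₁ atk∈) (proj₂ (at-range k∈))))
          (λ (a≤q+1 , _) → <⇒≱ q+1<a a≤q+1) 1+n≢n
          (inj₂ (≤-refl , <-≤-trans q+1<a (proj₁ atk∈)))))
      where
      q+1<a : suc (at (suc k)) < a
      q+1<a = ≤∧≢⇒< q<a q+1≢a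

    place : Dec (a ≤ at (suc k)) → Grown
    place (yes a≤q) = grow-right a≤q (≰⇒> (λ q≤b → q∉ (a≤q , q≤b)))
    place (no a≰q)  = grow-left (≰⇒> a≰q)

  -- once the block of 1..k reaches position n-1, a separated pair (k, k+1)
  -- must be a descent: were k+1 placed after k, any value sitting between
  -- them would lie inside the block, hence be at most k
  separated-at-right-edge : ∀ {k a b} → 1 ≤ k → suc k ≤ n → Block k a b →
    n ≤ suc b → T (sep k) → at (suc k) < at k
  separated-at-right-edge {k} {a} {b} 1≤k k<n block n≤b+1 sk with sep-sound 1≤k k<n sk
  ... | w , k+1<w , w≤n , inj₂ (q<atw , atw<atk) = <-trans q<atw atw<atk
  ... | w , k+1<w , w≤n , inj₁ (atk<atw , atw<q) =
    ⊥-elim (<⇒≱ k+1<w (m≤n⇒m≤1+n (proj₂ (block w∈) (a≤atw , atw≤b))))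
    where
    w∈ : w ∈[ 1 ⋯ n ]
    w∈ = ≤-trans (s≤s z≤n) (<⇒≤ k+1<w) , w≤n
    a≤atw : a ≤ at w
    a≤atw = ≤-trans (proj₁ (proj₁ (block (1≤k , ≤-trans (n≤1+n k) k<n)) ≤-refl)) (<⇒≤ atk<atw)
    atw≤b : at w ≤ b
    atw≤b = s≤s⁻¹ (≤-trans atw<q (≤-trans (proj₂ (at-range (s≤s z≤n , k<n))) n≤b+1))

  first-separated-descends : ∀ {i} → n ≤ suc (at 1) → 1 ≤ i → suc i ≤ n → T (sep i) →
    ∃[ j ] 1 ≤ j × j ≤ i × T (sep j) × at (suc j) < at j
  first-separated-descends {i} n≤at1+1 1≤i i<n si =
    scan (i ∸ 1) (m+[n∸m]≡n 1≤i) ≤-refl block-one n≤at1+1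
    where
    scan : ∀ d {k a b} → k + d ≡ i → 1 ≤ k → Block k a b → n ≤ suc b →
      ∃[ j ] 1 ≤ j × j ≤ i × T (sep j) × at (suc j) < at j
    scan d {k} k+d≡i 1≤k block n≤b+1 with T? (sep k)
    ... | yes sk =
      k , 1≤k , k≤i , sk , separated-at-right-edge 1≤k (≤-trans (s≤s k≤i) i<n) block n≤b+1 sk
      where
      k≤i : k ≤ i
      k≤i = subst (k ≤_) k+d≡i (m≤m+n k d)
    scan zero {k} k+0≡i 1≤k block n≤b+1 | no ¬sk =
      ⊥-elim (¬sk (subst (T ∘ sep) (trans (sym k+0≡i) (+-identityʳ k)) si))
    scan (suc d) {k} k+d+1≡i 1≤k block n≤b+1 | no ¬sk
      with block-grow 1≤k (≤-trans (subst (k <_) k+d+1≡i (m<m+n k z<s)) (≤-trans (n≤1+n i) i<n))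
             block ¬sk
    ... | _ , _ , _ , b≤b′ , block′ =
      scan d (trans (sym (+-suc k d)) k+d+1≡i) (s≤s z≤n) block′ (≤-trans n≤b+1 (s≤s b≤b′))

  ascent-has-earlier-descent : ∀ {i} → n ≤ suc (at 1) → 1 ≤ i → suc i ≤ n → T (sep i) →
    at i < at (suc i) → ∃[ j ] 1 ≤ j × j < i × T (sep j) × at (suc j) < at j
  ascent-has-earlier-descent n≤at1+1 1≤i i<n si ascent
    with first-separated-descends n≤at1+1 1≤i i<n si
  ... | j , 1≤j , j≤i , sj , descent with m≤n⇒m<n∨m≡n j≤i
  ...   | inj₁ j<i  = j , 1≤j , j<i , sj , descent
  ...   | inj₂ refl = ⊥-elim (<-asym ascent descent)

reflect-< : ∀ {m x y} → x < y → y ≤ m → m ∸ y < m ∸ x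
reflect-< x<y y≤m = ∸-monoʳ-< x<y y≤m

reflect-<⁻ : ∀ {m x y} → m ∸ y < m ∸ x → x < y
reflect-<⁻ {m} r = ≰⇒> (λ y≤x → <⇒≱ r (∸-monoʳ-≤ m y≤x))

reflect-between : ∀ {m a b c} → a ≤ m → b ≤ m → c ≤ m →
  Between a b c → Between (m ∸ a) (m ∸ b) (m ∸ c)
reflect-between a≤m b≤m c≤m (inj₁ (a<c , c<b)) = inj₂ (reflect-< c<b b≤m , reflect-< a<c c≤m)
reflect-between a≤m b≤m c≤m (inj₂ (b<c , c<a)) = inj₁ (reflect-< c<a a≤m , reflect-< b<c c≤m)

reflect-between⁻ : ∀ {m a b c} → Between (m ∸ a) (m ∸ b) (m ∸ c) → Between a b c
reflect-between⁻ (inj₁ (ma<mc , mc<mb)) = inj₂ (reflect-<⁻ mc<mb , reflect-<⁻ ma<mc)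
reflect-between⁻ (inj₂ (mb<mc , mc<ma)) = inj₁ (reflect-<⁻ mc<ma , reflect-<⁻ mb<mc)

reflect-range : ∀ {n x} → x ∈[ 1 ⋯ n ] → suc n ∸ x ∈[ 1 ⋯ n ]
reflect-range {n} (1≤x , x≤n) = m<n⇒0<n∸m (s≤s x≤n) , ∸-monoʳ-≤ (suc n) 1≤x

mirror : Layout → Layout
mirror L = record
  { size = n
  ; at = λ v → suc n ∸ at v
  ; sep = sep
  ; at-range = λ v∈ → reflect-range (at-range v∈)
  ; at-inj = λ v∈ w∈ e → at-inj v∈ w∈ (∸-cancelˡ-≡ (at≤ v∈) (at≤ w∈) e)
  ; at-onto = onto
  ; sep-sound = sound
  ; sep-complete = λ 1≤i i+1<k k≤n btw → sep-complete 1≤i i+1<k k≤n (reflect-between⁻ btw)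
  }
  where
  open Layout L renaming (size to n)
  at≤ : ∀ {v} → v ∈[ 1 ⋯ n ] → at v ≤ suc n
  at≤ v∈ = m≤n⇒m≤1+n (proj₂ (at-range v∈))
  onto : ∀ {x} → x ∈[ 1 ⋯ n ] → ∃[ v ] v ∈[ 1 ⋯ n ] × suc n ∸ at v ≡ x
  onto {x} x∈ with at-onto (reflect-range x∈)
  ... | v , v∈ , atv≡ = v , v∈ , trans (cong (suc n ∸_) atv≡) (m∸[m∸n]≡n (m≤n⇒m≤1+n (proj₂ x∈)))
  sound : ∀ {i} → 1 ≤ i → suc i ≤ n → T (sep i) →
    ∃[ k ] suc i < k × k ≤ n × Between (suc n ∸ at i) (suc n ∸ at (suc i)) (suc n ∸ at k)
  sound {i} 1≤i i<n si with sep-sound 1≤i i<n si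
  ... | k , i+1<k , k≤n , btw = k , i+1<k , k≤n ,
    reflect-between (at≤ (1≤i , ≤-trans (n≤1+n i) i<n)) (at≤ (s≤s z≤n , i<n))
      (at≤ (≤-trans (s≤s z≤n) (<⇒≤ i+1<k) , k≤n)) btw

descent-has-earlier-ascent : (L : Layout) → let open Layout L in
  at 1 ≤ 2 → ∀ {i} → 1 ≤ i → suc i ≤ size → T (sep i) →
  at (suc i) < at i → ∃[ j ] 1 ≤ j × j < i × T (sep j) × at j < at (suc j)
descent-has-earlier-ascent L at1≤2 {i} 1≤i i<n si descent =
  let j , 1≤j , j<i , sj , ascent =
        Blocks.ascent-has-earlier-descent (mirror L) n≤mirror-at1+1 1≤i i<n si mirrored-descent
  in j , 1≤j , j<i , sj , reflect-<⁻ ascent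
  where
  open Layout L renaming (size to n)
  n≤mirror-at1+1 : n ≤ suc (suc n ∸ at 1)
  n≤mirror-at1+1 = ≤-trans (m≤n+m∸n n 1) (s≤s (∸-monoʳ-≤ (suc n) at1≤2))
  mirrored-descent : suc n ∸ at i < suc n ∸ at (suc i)
  mirrored-descent = reflect-< descent (m≤n⇒m≤1+n (proj₂ (at-range (1≤i , ≤-trans (n≤1+n i) i<n))))

¬T⇒≡false : ∀ {b} → ¬ T b → b ≡ false
¬T⇒≡false {false} _ = refl
¬T⇒≡false {true}  h = ⊥-elim (h _)

anyᵇ-⇒ : ∀ {A : Set} (f : A → Bool) xs → T (anyᵇ f xs) → ∃[ x ] x ∈ xs × T (f x)
anyᵇ-⇒ f (x ∷ xs) h with Equivalence.to T-∨ h
... | inj₁ fx = x , here refl , fx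
... | inj₂ rest with anyᵇ-⇒ f xs rest
...   | y , y∈ , fy = y , there y∈ , fy

anyᵇ-⇐ : ∀ {A : Set} (f : A → Bool) xs {x} → x ∈ xs → T (f x) → T (anyᵇ f xs)
anyᵇ-⇐ f (x ∷ xs) (here refl) fx = Equivalence.from T-∨ (inj₁ fx)
anyᵇ-⇐ f (x ∷ xs) (there x∈) fx = Equivalence.from T-∨ (inj₂ (anyᵇ-⇐ f xs x∈ fx))

allᵇ-⇒ : ∀ {A : Set} (f : A → Bool) xs {x} → T (allᵇ f xs) → x ∈ xs → T (f x)
allᵇ-⇒ f (x ∷ xs) h (here refl) = proj₁ (Equivalence.to T-∧ h)
allᵇ-⇒ f (x ∷ xs) h (there x∈) = allᵇ-⇒ f xs (proj₂ (Equivalence.to T-∧ h)) x∈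

pos-head : ∀ v xs → pos v (v ∷ xs) ≡ 1
pos-head v xs rewrite Equivalence.to T-≡ (≡⇒≡ᵇ v v refl) = refl

pos-≥1 : ∀ {v xs} → v ∈ xs → 1 ≤ pos v xs
pos-tail : ∀ {x v xs} → x ≢ v → v ∈ xs → pos v (x ∷ xs) ≡ suc (pos v xs)

pos-≥1 {v} {x ∷ xs} (here refl) = ≤-reflexive (sym (pos-head v xs))
pos-≥1 {v} {x ∷ xs} (there v∈) with x ≟ v
... | yes refl = ≤-reflexive (sym (pos-head v xs))
... | no x≢v rewrite pos-tail x≢v v∈ = s≤s z≤n

pos-tail {x} {v} {xs} x≢v v∈ rewrite ¬T⇒≡false (x≢v ∘ ≡ᵇ⇒≡ x v) with pos v xs | pos-≥1 v∈
... | suc p | _ = refl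

∈-tail : ∀ {A : Set} {x v : A} {xs} → x ≢ v → v ∈ x ∷ xs → v ∈ xs
∈-tail x≢v (here refl) = ⊥-elim (x≢v refl)
∈-tail x≢v (there v∈)  = v∈

pos-range : ∀ {v xs} → v ∈ xs → pos v xs ∈[ 1 ⋯ length xs ]
pos-range {v} {x ∷ xs} v∈ with x ≟ v
... | yes refl rewrite pos-head v xs = ≤-refl , s≤s z≤n
... | no x≢v rewrite pos-tail x≢v (∈-tail x≢v v∈) =
  s≤s z≤n , s≤s (proj₂ (pos-range (∈-tail x≢v v∈)))

pos≢0 : ∀ {v xs} → v ∈ xs → pos v xs ≢ 0
pos≢0 v∈ e = 1+n≰n (subst (1 ≤_) e (pos-≥1 v∈))

pos-injective : ∀ {v w xs} → v ∈ xs → w ∈ xs → pos v xs ≡ pos w xs → v ≡ w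
pos-injective {v} {w} {x ∷ xs} v∈ w∈ e with x ≟ v | x ≟ w
... | yes refl | yes refl = refl
... | yes refl | no x≢w rewrite pos-head v xs | pos-tail x≢w (∈-tail x≢w w∈) =
  ⊥-elim (pos≢0 (∈-tail x≢w w∈) (suc-injective (sym e)))
... | no x≢v | yes refl rewrite pos-head w xs | pos-tail x≢v (∈-tail x≢v v∈) =
  ⊥-elim (pos≢0 (∈-tail x≢v v∈) (suc-injective e))
... | no x≢v | no x≢w rewrite pos-tail x≢v (∈-tail x≢v v∈) | pos-tail x≢w (∈-tail x≢w w∈) =
  pos-injective (∈-tail x≢v v∈) (∈-tail x≢w w∈) (suc-injective e)

head-fresh : ∀ {x v : ℕ} {xs} → Unique (x ∷ xs) → v ∈ xs → x ≢ v
head-fresh (x∉ ∷ _) v∈ = All.lookup x∉ v∈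

pos-onto : ∀ {xs q} → Unique xs → q ∈[ 1 ⋯ length xs ] → ∃[ v ] v ∈ xs × pos v xs ≡ q
pos-onto {x ∷ xs} {suc zero} _ _ = x , here refl , pos-head x xs
pos-onto {x ∷ xs} {suc (suc q)} u@(_ ∷ u′) (_ , s≤s q+1≤len) with pos-onto u′ (s≤s z≤n , q+1≤len)
... | v , v∈ , pos≡ = v , there v∈ , trans (pos-tail (head-fresh u v∈) v∈) (cong suc pos≡)

drop-⇒ : ∀ {y} p {xs} → Unique xs → y ∈ drop p xs → y ∈ xs × pos y xs ≡ p + pos y (drop p xs)
drop-⇒ zero _ y∈ = y∈ , refl
drop-⇒ (suc p) {x ∷ xs} u@(_ ∷ u′) y∈ with drop-⇒ p u′ y∈
... | y∈xs , pos≡ = there y∈xs , trans (pos-tail (head-fresh u y∈xs) y∈xs) (cong suc pos≡)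

drop-⇐ : ∀ {y} p {xs} → Unique xs → y ∈ xs → p < pos y xs → y ∈ drop p xs
drop-⇐ zero _ y∈ _ = y∈
drop-⇐ {y} (suc p) {x ∷ xs} _ (here refl) p<pos rewrite pos-head y xs =
  ⊥-elim (<⇒≱ p<pos (s≤s z≤n))
drop-⇐ (suc p) {x ∷ xs} u@(_ ∷ u′) (there y∈) p<pos =
  drop-⇐ p u′ y∈ (s≤s⁻¹ (subst (suc p <_) (pos-tail (head-fresh u y∈) y∈) p<pos))

take-⇒ : ∀ {y} m {xs} → y ∈ take m xs → y ∈ xs × pos y xs ≤ m
take-⇒ {y} (suc m) {x ∷ xs} y∈ with x ≟ y
... | yes refl rewrite pos-head y xs = here refl , s≤s z≤n
... | no x≢y with take-⇒ m (∈-tail x≢y y∈)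
...   | y∈xs , pos≤m rewrite pos-tail x≢y y∈xs = there y∈xs , s≤s pos≤m

take-⇐ : ∀ {y} m {xs} → y ∈ xs → pos y xs ≤ m → y ∈ take m xs
take-⇐ zero y∈ pos≤0 = ⊥-elim (pos≢0 y∈ (n≤0⇒n≡0 pos≤0))
take-⇐ {y} (suc m) {x ∷ xs} y∈ pos≤m with x ≟ y
... | yes refl = here refl
... | no x≢y rewrite pos-tail x≢y (∈-tail x≢y y∈) =
  there (take-⇐ m (∈-tail x≢y y∈) (s≤s⁻¹ pos≤m))

-- the offset arithmetic of `between`: the window take (q ∸ p ∸ 1) of the
-- entries after position p covers exactly the positions p+1, …, q-1
offset-⇒ : ∀ p q {d} → 1 ≤ d → d ≤ q ∸ p ∸ 1 → p + d < q
offset-⇒ zero    zero    1≤d d≤0 = ⊥-elim (<⇒≱ 1≤d d≤0)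
offset-⇒ zero    (suc q) _   d≤q = s≤s d≤q
offset-⇒ (suc p) zero    1≤d d≤0 = ⊥-elim (<⇒≱ 1≤d d≤0)
offset-⇒ (suc p) (suc q) 1≤d d≤  = s≤s (offset-⇒ p q 1≤d d≤)

offset-⇐ : ∀ p q {d} → p + d < q → d ≤ q ∸ p ∸ 1
offset-⇐ zero    (suc q) (s≤s d≤q) = d≤q
offset-⇐ (suc p) (suc q) (s≤s lt)  = offset-⇐ p q lt

between-⇒ : ∀ {y p q σ} → Unique σ → y ∈ between p q σ → y ∈ σ × p < pos y σ × pos y σ < q
between-⇒ {y} {p} {q} {σ} u y∈ with take-⇒ (q ∸ p ∸ 1) y∈
... | y∈drop , d≤ with drop-⇒ p u y∈drop
...   | y∈σ , pos≡ = y∈σ , subst (p <_) (sym pos≡) (m<m+n p 1≤d) ,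
                     subst (_< q) (sym pos≡) (offset-⇒ p q 1≤d d≤)
  where
  1≤d : 1 ≤ pos y (drop p σ)
  1≤d = pos-≥1 y∈drop

between-⇐ : ∀ {y p q σ} → Unique σ → y ∈ σ → p < pos y σ → pos y σ < q → y ∈ between p q σ
between-⇐ {y} {p} {q} {σ} u y∈ p<pos pos<q with drop-⇐ p u y∈ p<pos
... | y∈drop = take-⇐ (q ∸ p ∸ 1) y∈drop
                 (offset-⇐ p q (subst (_< q) (proj₂ (drop-⇒ p u y∈drop)) pos<q))

window : ℕ → ℕ → List ℕ → List ℕ
window p q σ = if p <ᵇ q then between p q σ else between q p σ

window-⇒ : ∀ {y σ} p q → Unique σ → y ∈ window p q σ → y ∈ σ × Between p q (pos y σ)
window-⇒ p q u y∈ with p <ᵇ q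
... | true  = let (y∈σ , p< , <q) = between-⇒ u y∈ in y∈σ , inj₁ (p< , <q)
... | false = let (y∈σ , q< , <p) = between-⇒ u y∈ in y∈σ , inj₂ (q< , <p)

window-⇐ : ∀ {y σ} p q → Unique σ → y ∈ σ → Between p q (pos y σ) → y ∈ window p q σ
window-⇐ p q u y∈ btw with p <ᵇ q in p<ᵇq | btw
... | true  | inj₁ (p< , <q) = between-⇐ u y∈ p< <q
... | true  | inj₂ (q< , <p) = ⊥-elim (<-asym (<ᵇ⇒< p q (subst T (sym p<ᵇq) _)) (<-trans q< <p))
... | false | inj₁ (p< , <q) = ⊥-elim (subst T p<ᵇq (<⇒<ᵇ (<-trans p< <q)))
... | false | inj₂ (q< , <p) = between-⇐ u y∈ q< <p

insertAll-↭ : ∀ x σ {τ} → τ ∈ insertAll x σ → τ ↭ x ∷ σ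
insertAll-↭ x []       (here refl) = ↭-refl
insertAll-↭ x (y ∷ ys) (here refl) = ↭-refl
insertAll-↭ x (y ∷ ys) (there τ∈) with ∈-map⁻ (y ∷_) τ∈
... | τ′ , τ′∈ , refl = ↭-trans (prep y (insertAll-↭ x ys τ′∈)) (swap y x ↭-refl)

perms-↭ : ∀ n {σ} → σ ∈ perms n → σ ↭ applyDownFrom suc n
perms-↭ zero    (here refl) = ↭-refl
perms-↭ (suc n) σ∈ with find (∈-concatMap⁻ (insertAll (suc n)) {xs = perms n} σ∈)
... | σ′ , σ′∈ , σ∈ins = ↭-trans (insertAll-↭ (suc n) σ′ σ∈ins) (prep (suc n) (perms-↭ n σ′∈))

module _ (n : ℕ) {σ} (σ∈ : σ ∈ perms n) where

  perm-length : length σ ≡ n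
  perm-length = trans (↭-length (perms-↭ n σ∈)) (length-applyDownFrom suc n)

  perm-unique : Unique σ
  perm-unique = Unique-resp-↭ (↭⇒↭ₛ (↭-sym (perms-↭ n σ∈)))
    (applyDownFrom⁺₁ suc n (λ j<i _ e → <⇒≢ j<i (sym (suc-injective e))))

  perm-∈⇒ : ∀ {v} → v ∈ σ → v ∈[ 1 ⋯ n ]
  perm-∈⇒ v∈ with ∈-applyDownFrom⁻ suc (∈-resp-↭ (perms-↭ n σ∈) v∈)
  ... | i , i<n , refl = s≤s z≤n , i<n

  perm-∈⇐ : ∀ {v} → v ∈[ 1 ⋯ n ] → v ∈ σ
  perm-∈⇐ {suc i} (_ , i<n) = ∈-resp-↭ (↭-sym (perms-↭ n σ∈)) (∈-applyDownFrom⁺ suc i<n)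

  permLayout : Layout
  permLayout = record
    { size = n
    ; at = λ v → pos v σ
    ; sep = isSeparated σ
    ; at-range = λ v∈ → subst (pos _ σ ∈[ 1 ⋯_]) perm-length (pos-range (perm-∈⇐ v∈))
    ; at-inj = λ v∈ w∈ → pos-injective (perm-∈⇐ v∈) (perm-∈⇐ w∈)
    ; at-onto = onto
    ; sep-sound = sound
    ; sep-complete = complete
    }
    where
    onto : ∀ {x} → x ∈[ 1 ⋯ n ] → ∃[ v ] v ∈[ 1 ⋯ n ] × pos v σ ≡ x
    onto x∈ with pos-onto perm-unique (subst (_ ∈[ 1 ⋯_]) (sym perm-length) x∈)
    ... | v , v∈ , pos≡ = v , perm-∈⇒ v∈ , pos≡
    sound : ∀ {i} → 1 ≤ i → suc i ≤ n → T (isSeparated σ i) →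
      ∃[ k ] suc i < k × k ≤ n × Between (pos i σ) (pos (suc i) σ) (pos k σ)
    sound {i} _ _ si with anyᵇ-⇒ (suc i <ᵇ_) (window (pos i σ) (pos (suc i) σ) σ) si
    ... | k , k∈ , i+1<ᵇk with window-⇒ (pos i σ) (pos (suc i) σ) perm-unique k∈
    ...   | k∈σ , btw = k , <ᵇ⇒< (suc i) k i+1<ᵇk , proj₂ (perm-∈⇒ k∈σ) , btw
    complete : ∀ {i k} → 1 ≤ i → suc i < k → k ≤ n →
      Between (pos i σ) (pos (suc i) σ) (pos k σ) → T (isSeparated σ i)
    complete {i} {k} _ i+1<k k≤n btw =
      anyᵇ-⇐ (suc i <ᵇ_) (window (pos i σ) (pos (suc i) σ) σ)
        (window-⇐ (pos i σ) (pos (suc i) σ) perm-unique k∈σ btw) (<⇒<ᵇ i+1<k)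
      where
      k∈σ : k ∈ σ
      k∈σ = perm-∈⇐ (≤-trans (s≤s z≤n) (<⇒≤ i+1<k) , k≤n)

<∸1⇒ : ∀ {j m} → j < m ∸ 1 → suc j < m
<∸1⇒ {m = suc m} j<m = s≤s j<m

<∸1⇐ : ∀ {j m} → suc j < m → j < m ∸ 1
<∸1⇐ {m = suc m} (s≤s j<m) = j<m

sepPairs-⇒ : ∀ σ {i b} → (i , b) ∈ sepPairs σ →
  1 ≤ i × suc i ≤ length σ × T (isSeparated σ i) × b ≡ isUp σ i
sepPairs-⇒ σ ib∈ with ∈-map⁻ (λ i → i , isUp σ i) ib∈
... | i , i∈ , refl with ∈-filter⁻ (T? ∘ isSeparated σ) {xs = applyUpTo suc (length σ ∸ 1)} i∈
...   | i∈range , si with ∈-applyUpTo⁻ suc i∈range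
...     | j , j<len∸1 , refl = s≤s z≤n , <∸1⇒ j<len∸1 , si , refl

sepPairs-⇐ : ∀ σ {i} → 1 ≤ i → suc i ≤ length σ → T (isSeparated σ i) →
  (i , isUp σ i) ∈ sepPairs σ
sepPairs-⇐ σ {suc j} _ j+2≤len si = ∈-map⁺ (λ i → i , isUp σ i)
  (∈-filter⁺ (T? ∘ isSeparated σ) (∈-applyUpTo⁺ suc {n = length σ ∸ 1} (<∸1⇐ j+2≤len)) si)

sepPairs-sorted : ∀ σ → AllPairs (λ x y → proj₁ x < proj₁ y) (sepPairs σ)
sepPairs-sorted σ = AllPairs.map⁺ (AllPairs.filter⁺ (T? ∘ isSeparated σ)
  (AllPairs.applyUpTo⁺₁ suc (length σ ∸ 1) (λ i<j _ → s≤s i<j)))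

[]∈sublists : ∀ {A : Set} (L : List A) → [] ∈ sublists L
[]∈sublists []       = here refl
[]∈sublists (y ∷ ys) = ∈-++⁺ʳ (map (y ∷_) (sublists ys)) ([]∈sublists ys)

sublists-head : ∀ {A : Set} (L : List A) {h r} → h ∷ r ∈ sublists L → h ∈ L
sublists-head []       (here ())
sublists-head []       (there ())
sublists-head (y ∷ ys) hr∈ with ∈-++⁻ (map (y ∷_) (sublists ys)) hr∈
... | inj₁ hr∈map = here (∷-injectiveˡ (proj₂ (proj₂ (∈-map⁻ (y ∷_) hr∈map))))
... | inj₂ hr∈ys  = there (sublists-head ys hr∈ys)

sublists-prepend : ∀ {A : Set} {R : A → A → Set} → (∀ {a b} → R a b → ¬ R b a) →
  ∀ {L h r x} → AllPairs R L → h ∷ r ∈ sublists L → x ∈ L → R x h → x ∷ h ∷ r ∈ sublists L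
sublists-prepend asym {y ∷ ys} (y≺ys ∷ sorted) hr∈ x∈ x≺h
  with ∈-++⁻ (map (y ∷_) (sublists ys)) hr∈ | x∈
... | inj₁ hr∈map | x∈L with ∈-map⁻ (y ∷_) hr∈map
...   | _ , _ , refl with x∈L
...     | here refl  = ⊥-elim (asym x≺h x≺h)
...     | there x∈ys = ⊥-elim (asym x≺h (All.lookup y≺ys x∈ys))
sublists-prepend asym {y ∷ ys} _ hr∈ x∈ x≺h | inj₂ hr∈ys | here refl =
  ∈-++⁺ˡ (∈-map⁺ (y ∷_) hr∈ys)
sublists-prepend asym {y ∷ ys} (_ ∷ sorted) hr∈ x∈ x≺h | inj₂ hr∈ys | there x∈ys =
  ∈-++⁺ʳ (map (y ∷_) (sublists ys)) (sublists-prepend asym sorted hr∈ys x∈ys x≺h)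

maxLength : ∀ {A : Set} → List (List A) → ℕ
maxLength l = foldr _⊔_ 0 (map length l)

length≤maxLength : ∀ {A : Set} {l : List (List A)} {s} → s ∈ l → length s ≤ maxLength l
length≤maxLength {l = s ∷ l} (here refl) = m≤m⊔n (length s) (maxLength l)
length≤maxLength {l = s ∷ l} (there s∈) =
  ≤-trans (length≤maxLength s∈) (m≤n⊔m (length s) (maxLength l))

longest-cons : ∀ {A : Set} (s : List A) l → ∃[ t ] t ∈ s ∷ l × length t ≡ maxLength (s ∷ l)
longest-cons s []       = s , here refl , sym (⊔-identityʳ (length s))
longest-cons s (s′ ∷ l) = pick (⊔-sel (length s) (maxLength (s′ ∷ l))) (longest-cons s′ l)
  where
  pick : let m = maxLength (s′ ∷ l) in length s ⊔ m ≡ length s ⊎ length s ⊔ m ≡ m →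
    ∃[ t ] t ∈ s′ ∷ l × length t ≡ maxLength (s′ ∷ l) →
    ∃[ t ] t ∈ s ∷ s′ ∷ l × length t ≡ maxLength (s ∷ s′ ∷ l)
  pick (inj₁ max≡s)    _                = s , here refl , sym max≡s
  pick (inj₂ max≡rest) (t , t∈ , len≡) = t , there t∈ , trans len≡ (sym max≡rest)

longest : ∀ {A : Set} {l : List (List A)} {s₀} → s₀ ∈ l → ∃[ t ] t ∈ l × length t ≡ maxLength l
longest {l = s ∷ l} _ = longest-cons s l

[]∈isasps : ∀ σ → [] ∈ isasps σ
[]∈isasps σ = ∈-filter⁺ (T? ∘ alternating) ([]∈sublists (sepPairs σ)) _

alternating-prepend : ∀ o j i r → T (alternating ((i , o) ∷ r)) →
  T (alternating ((j , not o) ∷ (i , o) ∷ r))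
alternating-prepend true  j i r alt = alt
alternating-prepend false j i r alt = alt

begins-with⇒ : ∀ o {i b r} → T (beginsWith o ((i , b) ∷ r)) → b ≡ o
begins-with⇒ true  {b = true}  _ = refl
begins-with⇒ false {b = false} _ = refl

if-true : ∀ {c x y : Bool} → T c → T (if c then x else y) → T x
if-true {true} _ t = t

not-oriented : ∀ o σ →
  (∀ {i r} → (i , o) ∷ r ∈ isasps σ → ∃[ j ] (j , not o) ∈ sepPairs σ × j < i) →
  ¬ T (oriented o σ)
not-oriented o σ prolong oriented-o with longest ([]∈isasps σ)
... | s , s∈ , len≡max = not-first s s∈ len≡max
  (if-true (≡⇒≡ᵇ _ _ len≡max)
    (allᵇ-⇒ maximal-begins (isasps σ) (proj₂ (Equivalence.to T-∧ oriented-o)) s∈))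
  where
  maximal-begins : List (ℕ × Bool) → Bool
  maximal-begins s = if length s ≡ᵇ maxISASPLength σ then beginsWith o s else true
  not-first : ∀ s → s ∈ isasps σ → length s ≡ maxISASPLength σ → ¬ T (beginsWith o s)
  not-first [] _ _ ()
  not-first ((i , b) ∷ r) s∈ len≡max begins with begins-with⇒ o {i} {b} {r} begins
  ... | refl with prolong s∈ | ∈-filter⁻ (T? ∘ alternating) {xs = sublists (sepPairs σ)} s∈
  ...   | j , j∈ , j<i | s∈sublists , alt =
    1+n≰n (subst (suc (suc (length r)) ≤_) (sym len≡max) (length≤maxLength longer∈))
    where
    longer∈ : (j , not o) ∷ (i , o) ∷ r ∈ isasps σ
    longer∈ = ∈-filter⁺ (T? ∘ alternating)
      (sublists-prepend <-asym (sepPairs-sorted σ) s∈sublists j∈ j<i)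
      (alternating-prepend o j i r alt)

module _ (n : ℕ) {σ} (σ∈ : σ ∈ perms n) where
  open Layout (permLayout n σ∈) using (at-inj)

  isasp-head : ∀ {i b r} → (i , b) ∷ r ∈ isasps σ →
    1 ≤ i × suc i ≤ n × T (isSeparated σ i) × b ≡ isUp σ i
  isasp-head s∈ with ∈-filter⁻ (T? ∘ alternating) {xs = sublists (sepPairs σ)} s∈
  ... | s∈sublists , _ with sepPairs-⇒ σ (sublists-head (sepPairs σ) s∈sublists)
  ...   | 1≤i , i<len , si , b≡ = 1≤i , subst (suc _ ≤_) (perm-length n σ∈) i<len , si , b≡

  up⇒ascent : ∀ {i} → true ≡ isUp σ i → pos i σ < pos (suc i) σ
  up⇒ascent up = <ᵇ⇒< _ _ (subst T up _)

  down⇒descent : ∀ {i} → 1 ≤ i → suc i ≤ n → false ≡ isUp σ i → pos (suc i) σ < pos i σ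
  down⇒descent {i} 1≤i i<n down = ≤∧≢⇒< (≮⇒≥ (λ ascent → subst T (sym down) (<⇒<ᵇ ascent)))
    (λ e → 1+n≢n (at-inj (s≤s z≤n , i<n) (1≤i , ≤-trans (n≤1+n i) i<n) e))

  earlier-pair : ∀ {i j} o → suc i ≤ n → 1 ≤ j → j < i → T (isSeparated σ j) → isUp σ j ≡ o →
    ∃[ k ] (k , o) ∈ sepPairs σ × k < i
  earlier-pair {i} {j} o i<n 1≤j j<i sj refl = j , sepPairs-⇐ σ 1≤j j+1≤len sj , j<i
    where
    j+1≤len : suc j ≤ length σ
    j+1≤len = subst (suc j ≤_) (sym (perm-length n σ∈)) (≤-trans j<i (≤-trans (n≤1+n i) i<n))

  up-prolongs : n ≤ suc (pos 1 σ) → ∀ {i r} → (i , true) ∷ r ∈ isasps σ →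
    ∃[ j ] (j , false) ∈ sepPairs σ × j < i
  up-prolongs edge s∈ with isasp-head s∈
  ... | 1≤i , i<n , si , up
    with Blocks.ascent-has-earlier-descent (permLayout n σ∈) edge 1≤i i<n si (up⇒ascent up)
  ...   | j , 1≤j , j<i , sj , descent =
    earlier-pair false i<n 1≤j j<i sj (¬T⇒≡false (λ ascent → <-asym (<ᵇ⇒< _ _ ascent) descent))

  down-prolongs : pos 1 σ ≤ 2 → ∀ {i r} → (i , false) ∷ r ∈ isasps σ →
    ∃[ j ] (j , true) ∈ sepPairs σ × j < i
  down-prolongs at1≤2 s∈ with isasp-head s∈
  ... | 1≤i , i<n , si , down
    with descent-has-earlier-ascent (permLayout n σ∈) at1≤2 1≤i i<n si (down⇒descent 1≤i i<n down)
  ...   | j , 1≤j , j<i , sj , ascent =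
    earlier-pair true i<n 1≤j j<i sj (Equivalence.to T-≡ (<⇒<ᵇ ascent))

count-zero : ∀ M n t k → (∀ {σ} → σ ∈ perms n → pos 1 σ ≡ k → ¬ T (M σ)) → count M n t k ≡ 0
count-zero M n t k excluded = cong length (filter-none (T? ∘ selected) (All.tabulate rejected))
  where
  selected : List ℕ → Bool
  selected σ = M σ ∧ (revTier σ ≡ᵇ t) ∧ (pos 1 σ ≡ᵇ k)
  rejected : ∀ {σ} → σ ∈ perms n → ¬ T (selected σ)
  rejected σ∈ sel with Equivalence.to T-∧ sel
  ... | inM , rest = excluded σ∈ (≡ᵇ⇒≡ _ _ (proj₂ (Equivalence.to T-∧ rest))) inM

mainTheorem11 : (n t : ℕ) → 1 ≤ n →
    (μU n t n ≡ 0 × μU n t (n ∸ 1) ≡ 0) × (μD n t 1 ≡ 0 × μD n t 2 ≡ 0)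
mainTheorem11 n t _ =
    ( count-zero isUpOriented n t n (not-up (n≤1+n n))
    , count-zero isUpOriented n t (n ∸ 1) (not-up (m≤n+m∸n n 1)) )
  , ( count-zero isDownOriented n t 1 (not-down (n≤1+n 1))
    , count-zero isDownOriented n t 2 (not-down ≤-refl) )
  where
  not-up : ∀ {k} → n ≤ suc k → ∀ {σ} → σ ∈ perms n → pos 1 σ ≡ k → ¬ T (isUpOriented σ)
  not-up n≤k+1 {σ} σ∈ refl = not-oriented true σ (up-prolongs n σ∈ n≤k+1)
  not-down : ∀ {k} → k ≤ 2 → ∀ {σ} → σ ∈ perms n → pos 1 σ ≡ k → ¬ T (isDownOriented σ)
  not-down k≤2 {σ} σ∈ refl = not-oriented false σ (down-prolongs n σ∈ k≤2)
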